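{- Let $G=(V,E)$ be a simple connected undirected graph with maximum degree $\Delta(G)$, and let $w\in V$. Construct a bipartite graph $\hat G=(P\sqcup Q,\hat E)$ as follows. Let $P=\{u^i : u\in V,\ i\in\{1,\dots,\Delta(G)+1\}\}$ (i.e. $\Delta(G)+1$ copies of each vertex of $G$). For each $u\in V$ let $R(u)=\{r_u^1,\dots,r_u^{\Delta(G)+1-d_G(u)}\}$ be a set of new vertices, and for each edge $e\in E$ let $e^1,e^2$ be two new vertices; put $Q=\{e^j : e\in E,\ j\in\{1,2\}\}\cup\bigcup_{u\in V}R(u)$. Let $E'=\{u^ie^j : e\in E,\ u \text{ an endpoint of } e,\ i\in\{1,\dots,\Delta(G)+1\},\ j\in\{1,2\}\}\cup\{u^ir : u\in V,\ r\in R(u),\ i\in\{1,\dots,\Delta(G)+1\}\}$, and $\hat E=E'\cup\{w^iq : i\in\{1,\dots,\Delta(G)+1\},\ q\in Q,\ w^iq\notin E'\}$. Then the partition completion $C(\hat G)$ is moral.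
   Context: $d_G(u)$ is the degree of $u$ in $G$. The partition completion $C(\hat G)$ is obtained from $\hat G$ by adding all edges between distinct vertices of $P$ and all edges between distinct vertices of $Q$. For a directed acyclic graph $D=(V,A)$, its moral graph is the undirected graph on $V$ in which $u\neq v$ are adjacent iff they are adjacent in $D$ or are both parents of a common vertex. An undirected graph is moral if it is the moral graph of some directed acyclic graph. -}

module Defs where

open import Data.Nat using (ℕ; zero; suc; _∸_; _⊔_)
open import Data.Fin using (Fin; _<_)
open import Data.List using (List; map; foldr; allFin)
open import Data.Nat.ListAction using (sum)
open import Data.Bool using (Bool; true; false; if_then_else_)
open import Data.Product using (Σ; _×_; _,_; ∃)
open import Data.Sum using (_⊎_)
open import Data.Empty using (⊥)
open import Relation.Nullary using (¬_)
open import Relation.Binary.PropositionalEquality using (_≡_; _≢_)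
open import Function.Bundles using (_⇔_)
open import Level using (Level)

record Graph (n : ℕ) : Set where
  field
    adj    : Fin n → Fin n → Bool
    sym    : ∀ u v → adj u v ≡ adj v u
    irrefl : ∀ u → adj u u ≡ false
open Graph public

deg : ∀ {n} → Graph n → Fin n → ℕ
deg G u = sum (map (λ v → if adj G u v then 1 else 0) (allFin _))

maxDeg : ∀ {n} → Graph n → ℕ
maxDeg G = foldr _⊔_ 0 (map (deg G) (allFin _))

data Walk {n} (G : Graph n) : Fin n → Fin n → Set where
  nil  : ∀ {u} → Walk G u u
  cons : ∀ {u v x} → adj G u v ≡ true → Walk G v x → Walk G u x

Connected : ∀ {n} → Graph n → Set
Connected {n} G = (u v : Fin n) → Walk G u v

-- edges of G, each listed once as {a,b} with a < b
Edge : ∀ {n} → Graph n → Set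
Edge {n} G = Σ (Fin n) λ a → Σ (Fin n) λ b → (a < b) × (adj G a b ≡ true)

data HatV {n} (G : Graph n) : Set where
  -- u^i ∈ P,  i ∈ {1,…,Δ(G)+1}
  pv : Fin n → Fin (suc (maxDeg G)) → HatV G
  -- e^j ∈ Q,  j ∈ {1,2}
  qe : Edge G → Fin 2 → HatV G
  -- r_u^k ∈ R(u) ⊆ Q,  k ∈ {1,…,Δ(G)+1-d_G(u)}
  qr : (u : Fin n) → Fin (suc (maxDeg G) ∸ deg G u) → HatV G

-- E' between a vertex u^i of P and a vertex of Q
E′ : ∀ {n} {G : Graph n} → Fin n → HatV G → Set
E′ u (pv _ _)            = ⊥
E′ u (qe (a , b , _) j)  = (u ≡ a) ⊎ (u ≡ b)
E′ u (qr v k)            = u ≡ v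

-- Ê = E' ∪ {w^i q : q ∈ Q}  (between u^i ∈ P and q ∈ Q)
Ê : ∀ {n} {G : Graph n} → Fin n → Fin n → HatV G → Set
Ê w u q = E′ u q ⊎ (u ≡ w)

CĜ : ∀ {n} (G : Graph n) (w : Fin n) → HatV G → HatV G → Set
CĜ G w x@(pv _ _) y@(pv _ _) = x ≢ y
CĜ G w (pv u i)   y@(qe _ _) = Ê w u y
CĜ G w (pv u i)   y@(qr _ _) = Ê w u y
CĜ G w x@(qe _ _) (pv u i)   = Ê w u x
CĜ G w x@(qr _ _) (pv u i)   = Ê w u x
CĜ G w x@(qe _ _) y@(qe _ _) = x ≢ y
CĜ G w x@(qe _ _) y@(qr _ _) = x ≢ y
CĜ G w x@(qr _ _) y@(qe _ _) = x ≢ y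
CĜ G w x@(qr _ _) y@(qr _ _) = x ≢ y

data DPath {V : Set} (A : V → V → Set) : V → V → Set where
  step : ∀ {x y}   → A x y → DPath A x y
  _∷_  : ∀ {x y z} → A x y → DPath A y z → DPath A x z

Acyclic : {V : Set} → (V → V → Set) → Set
Acyclic {V} A = (x : V) → ¬ DPath A x x

MoralAdj : {V : Set} → (V → V → Set) → V → V → Set
MoralAdj {V} A u v =
  (u ≢ v) × (A u v ⊎ A v u ⊎ Σ V λ c → A u c × A v c)

Moral : (V : Set) → (V → V → Set) → Set₁
Moral V adjR = Σ (V → V → Set) λ A →
  Acyclic A × ((u v : V) → adjR u v ⇔ MoralAdj A u v)

-- Orient Ĝ from P to Q, orient all other edges inside P towards the sink w¹, and
-- those inside Q towards a sink r ∈ R(w), which exists because d_G(w) ≤ Δ(G).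
-- Marrying the parents of the two sinks turns P and Q into cliques, and the only
-- other parents that get married are a parent of r and a vertex of Q. The parents
-- of r in P are exactly the copies of w, which Ĝ already joins to all of Q.
module Submission where

open import Defs hiding (sym)
open import Data.Fin as Fin using (Fin; zero)
open import Data.Nat using (ℕ; suc; _≤_; _∸_; _⊔_)
open import Data.Nat.Properties using (m≤m⊔n; m≤n⊔m; ≤-trans; +-∸-assoc)
open import Data.List using (List; _∷_; foldr; map; allFin)
open import Data.List.Relation.Unary.Any using (here; there)
open import Data.List.Membership.Propositional using (_∈_)
open import Data.List.Membership.Propositional.Properties using (∈-allFin)
open import Data.Product using (Σ; _×_; _,_)
open import Data.Product.Properties using (≡-dec)
open import Data.Sum using (_⊎_; inj₁; inj₂)
open import Data.Sum.Properties using (inj₂-injective)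
open import Function using (_∘_)
open import Function.Bundles using (_⇔_; mk⇔; Equivalence; _↔_; Inverse; Injection; mk↔ₛ′)
open import Function.Properties.Inverse using (↔⇒↣)
import Function.Properties.Equivalence as ⇔
open import Relation.Nullary using (¬_; Dec; yes; no)
open import Relation.Nullary.Decidable using (map′)
open import Relation.Binary.PropositionalEquality
  using (_≡_; _≢_; refl; sym; cong; subst)

MoralLink : {V : Set} → (V → V → Set) → V → V → Set
MoralLink {V} A u v = A u v ⊎ A v u ⊎ Σ V λ c → A u c × A v c

moralLink-sym : {V : Set} {A : V → V → Set} {u v : V} →
                MoralLink A u v → MoralLink A v u
moralLink-sym (inj₁ uv)                   = inj₂ (inj₁ uv)
moralLink-sym (inj₂ (inj₁ vu))            = inj₁ vu
moralLink-sym (inj₂ (inj₂ (c , uc , vc))) = inj₂ (inj₂ (c , vc , uc))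

sink-links : {S V : Set} {A : V → V → Set} (ι : S → V) {s : S} →
             (∀ x → Dec (x ≡ s)) → (∀ {x} → x ≢ s → A (ι x) (ι s)) →
             ∀ {x y} → x ≢ y → MoralLink A (ι x) (ι y)
sink-links ι _≟s into-s {x} {y} x≢y with y ≟s | x ≟s
... | yes refl | _        = inj₁ (into-s x≢y)
... | no y≢s   | yes refl = inj₂ (inj₁ (into-s y≢s))
... | no y≢s   | no x≢s   = inj₂ (inj₂ (ι _ , into-s x≢s , into-s y≢s))

module _ {V W : Set} (f : V ↔ W) where
  open Inverse f using (to; from; strictlyInverseˡ)

  ≢⇔to≢ : ∀ {x y} → x ≢ y ⇔ to x ≢ to y
  ≢⇔to≢ = mk⇔ (λ x≢y → x≢y ∘ Injection.injective (↔⇒↣ f)) (λ tx≢ty → tx≢ty ∘ cong to)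

  moral-transport : {R : V → V → Set} {S : W → W → Set} →
                    (∀ x y → R x y ⇔ S (to x) (to y)) → Moral W S → Moral V R
  moral-transport R⇔S (A , acyclic , S⇔moral) =
    A′ , (λ x → acyclic (to x) ∘ path-to) , λ x y →
      ⇔.trans (R⇔S x y) (⇔.trans (S⇔moral (to x) (to y)) (moralAdj-from x y))
    where
    A′ : V → V → Set
    A′ x y = A (to x) (to y)

    path-to : ∀ {x y} → DPath A′ x y → DPath A (to x) (to y)
    path-to (step a) = step a
    path-to (a ∷ as) = a ∷ path-to as

    link-from : ∀ {x y} → MoralLink A (to x) (to y) → MoralLink A′ x y
    link-from (inj₁ a)                  = inj₁ a
    link-from (inj₂ (inj₁ a))           = inj₂ (inj₁ a)
    link-from {x} {y} (inj₂ (inj₂ (c , xc , yc))) =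
      inj₂ (inj₂ (from c , back (A (to x)) xc , back (A (to y)) yc))
      where
      back : (B : W → Set) → B c → B (to (from c))
      back B = subst B (sym (strictlyInverseˡ c))

    link-to : ∀ {x y} → MoralLink A′ x y → MoralLink A (to x) (to y)
    link-to (inj₁ a)                  = inj₁ a
    link-to (inj₂ (inj₁ a))           = inj₂ (inj₁ a)
    link-to (inj₂ (inj₂ (c , xc , yc))) = inj₂ (inj₂ (to c , xc , yc))

    moralAdj-from : ∀ x y → MoralAdj A (to x) (to y) ⇔ MoralAdj A′ x y
    moralAdj-from x y =
      mk⇔ (λ (tx≢ty , l) → Equivalence.from ≢⇔to≢ tx≢ty , link-from l)
          (λ (x≢y , l) → Equivalence.to ≢⇔to≢ x≢y , link-to l)

PartitionCompletion : {P Q : Set} → (P → Q → Set) → P ⊎ Q → P ⊎ Q → Set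
PartitionCompletion B x@(inj₁ _) y@(inj₁ _) = x ≢ y
PartitionCompletion B (inj₁ p)   (inj₂ q)   = B p q
PartitionCompletion B (inj₂ q)   (inj₁ p)   = B p q
PartitionCompletion B x@(inj₂ _) y@(inj₂ _) = x ≢ y

module PartitionCompletionMoral
  {P Q : Set} (B : P → Q → Set)
  (p₀ : P) (_≟p₀ : ∀ p → Dec (p ≡ p₀))
  (q₀ : Q) (_≟q₀ : ∀ q → Dec (q ≡ q₀))
  (joined-to-Q : ∀ p q → B p q₀ → B p q)
  where

  data Arc : P ⊎ Q → P ⊎ Q → Set where
    intoP₀ : ∀ {p} → p ≢ p₀ → Arc (inj₁ p) (inj₁ p₀)
    intoQ₀ : ∀ {q} → q ≢ q₀ → Arc (inj₂ q) (inj₂ q₀)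
    across : ∀ {p q} → B p q → Arc (inj₁ p) (inj₂ q)

  no-path-Q→P : ∀ {q p} → ¬ DPath Arc (inj₂ q) (inj₁ p)
  no-path-Q→P (step ())
  no-path-Q→P (intoQ₀ _ ∷ path) = no-path-Q→P path

  no-path-from-q₀ : ∀ {y} → ¬ DPath Arc (inj₂ q₀) y
  no-path-from-q₀ (step (intoQ₀ q₀≢q₀)) = q₀≢q₀ refl
  no-path-from-q₀ (intoQ₀ q₀≢q₀ ∷ _)    = q₀≢q₀ refl

  no-path-p₀→P : ∀ {p} → ¬ DPath Arc (inj₁ p₀) (inj₁ p)
  no-path-p₀→P (step (intoP₀ p₀≢p₀)) = p₀≢p₀ refl
  no-path-p₀→P (intoP₀ p₀≢p₀ ∷ _)    = p₀≢p₀ refl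
  no-path-p₀→P (across _ ∷ path)     = no-path-Q→P path

  acyclic : Acyclic Arc
  acyclic (inj₁ _) (step (intoP₀ p₀≢p₀)) = p₀≢p₀ refl
  acyclic (inj₁ _) (intoP₀ _ ∷ path)     = no-path-p₀→P path
  acyclic (inj₁ _) (across _ ∷ path)     = no-path-Q→P path
  acyclic (inj₂ _) (step (intoQ₀ q₀≢q₀)) = q₀≢q₀ refl
  acyclic (inj₂ _) (intoQ₀ _ ∷ path)     = no-path-from-q₀ path

  link⇒joined : ∀ {p q} → MoralLink Arc (inj₁ p) (inj₂ q) → B p q
  link⇒joined (inj₁ (across b))                       = b
  link⇒joined (inj₂ (inj₁ ()))
  link⇒joined (inj₂ (inj₂ (_ , across b , intoQ₀ _))) = joined-to-Q _ _ b

  completion⇔moralAdj : ∀ x y → PartitionCompletion B x y ⇔ MoralAdj Arc x y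
  completion⇔moralAdj (inj₁ _) (inj₁ _) = mk⇔
    (λ x≢y → x≢y , sink-links {A = Arc} inj₁ _≟p₀ intoP₀ (x≢y ∘ cong inj₁))
    (λ (x≢y , _) → x≢y)
  completion⇔moralAdj (inj₁ _) (inj₂ _) = mk⇔
    (λ b → (λ ()) , inj₁ (across b))
    (λ (_ , link) → link⇒joined link)
  completion⇔moralAdj (inj₂ _) (inj₁ _) = mk⇔
    (λ b → (λ ()) , inj₂ (inj₁ (across b)))
    (λ (_ , link) → link⇒joined (moralLink-sym {A = Arc} link))
  completion⇔moralAdj (inj₂ _) (inj₂ _) = mk⇔
    (λ x≢y → x≢y , sink-links {A = Arc} inj₂ _≟q₀ intoQ₀ (x≢y ∘ cong inj₂))
    (λ (x≢y , _) → x≢y)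

  partitionCompletion-moral : Moral (P ⊎ Q) (PartitionCompletion B)
  partitionCompletion-moral = Arc , acyclic , completion⇔moralAdj

open PartitionCompletionMoral using (partitionCompletion-moral)

≤-foldr-⊔ : {A : Set} (f : A → ℕ) {x : A} (xs : List A) → x ∈ xs → f x ≤ foldr _⊔_ 0 (map f xs)
≤-foldr-⊔ f (y ∷ ys) (here refl)  = m≤m⊔n (f y) _
≤-foldr-⊔ f (y ∷ ys) (there x∈ys) = ≤-trans (≤-foldr-⊔ f ys x∈ys) (m≤n⊔m (f y) _)

module _ {n : ℕ} (G : Graph n) where

  deg≤maxDeg : ∀ u → deg G u ≤ maxDeg G
  deg≤maxDeg u = ≤-foldr-⊔ (deg G) (allFin n) (∈-allFin u)

  first-reserve : (u : Fin n) → Fin (suc (maxDeg G) ∸ deg G u)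
  first-reserve u = subst Fin (sym (+-∸-assoc 1 (deg≤maxDeg u))) zero

  PVertex : Set
  PVertex = Fin n × Fin (suc (maxDeg G))

  QVertex : Set
  QVertex = (Edge G × Fin 2) ⊎ Σ (Fin n) λ u → Fin (suc (maxDeg G) ∸ deg G u)

  qVertex : QVertex → HatV G
  qVertex (inj₁ (e , j)) = qe e j
  qVertex (inj₂ (u , k)) = qr u k

  sides : HatV G → PVertex ⊎ QVertex
  sides (pv u i) = inj₁ (u , i)
  sides (qe e j) = inj₂ (inj₁ (e , j))
  sides (qr u k) = inj₂ (inj₂ (u , k))

  unsides : PVertex ⊎ QVertex → HatV G
  unsides (inj₁ (u , i)) = pv u i
  unsides (inj₂ q)       = qVertex q

  sides-inverse : HatV G ↔ (PVertex ⊎ QVertex)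
  sides-inverse = mk↔ₛ′ sides unsides sides∘unsides unsides∘sides
    where
    sides∘unsides : ∀ x → sides (unsides x) ≡ x
    sides∘unsides (inj₁ _)        = refl
    sides∘unsides (inj₂ (inj₁ _)) = refl
    sides∘unsides (inj₂ (inj₂ _)) = refl

    unsides∘sides : ∀ x → unsides (sides x) ≡ x
    unsides∘sides (pv _ _) = refl
    unsides∘sides (qe _ _) = refl
    unsides∘sides (qr _ _) = refl

  module _ (w : Fin n) where

    Ĝ-between : PVertex → QVertex → Set
    Ĝ-between (u , _) q = Ê w u (qVertex q)

    CĜ⇔completion : ∀ x y → CĜ G w x y ⇔ PartitionCompletion Ĝ-between (sides x) (sides y)
    CĜ⇔completion (pv _ _) (pv _ _) = ≢⇔to≢ sides-inverse
    CĜ⇔completion (pv _ _) (qe _ _) = ⇔.refl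
    CĜ⇔completion (pv _ _) (qr _ _) = ⇔.refl
    CĜ⇔completion (qe _ _) (pv _ _) = ⇔.refl
    CĜ⇔completion (qr _ _) (pv _ _) = ⇔.refl
    CĜ⇔completion (qe _ _) (qe _ _) = ≢⇔to≢ sides-inverse
    CĜ⇔completion (qe _ _) (qr _ _) = ≢⇔to≢ sides-inverse
    CĜ⇔completion (qr _ _) (qe _ _) = ≢⇔to≢ sides-inverse
    CĜ⇔completion (qr _ _) (qr _ _) = ≢⇔to≢ sides-inverse

    w-copy : PVertex
    w-copy = w , zero

    w-reserve : QVertex
    w-reserve = inj₂ (w , first-reserve w)

    _≟w-copy : ∀ p → Dec (p ≡ w-copy)
    p ≟w-copy = ≡-dec Fin._≟_ Fin._≟_ p w-copy

    _≟w-reserve : ∀ q → Dec (q ≡ w-reserve)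
    inj₁ _ ≟w-reserve = no λ ()
    inj₂ r ≟w-reserve = map′ (cong inj₂) inj₂-injective (≡-dec Fin._≟_ Fin._≟_ r (w , first-reserve w))

    w-reserve-neighbours-joined : ∀ p q → Ĝ-between p w-reserve → Ĝ-between p q
    w-reserve-neighbours-joined _ _ (inj₁ u≡w) = inj₂ u≡w
    w-reserve-neighbours-joined _ _ (inj₂ u≡w) = inj₂ u≡w

lemma6 : ∀ {n} (G : Graph n) → Connected G → (w : Fin n) → Moral (HatV G) (CĜ G w)
lemma6 G _ w =
  moral-transport (sides-inverse G) (CĜ⇔completion G w)
    (partitionCompletion-moral (Ĝ-between G w)
      (w-copy G w) (_≟w-copy G w) (w-reserve G w) (_≟w-reserve G w)
      (w-reserve-neighbours-joined G w))
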